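{- Let $n$ be a positive integer and $\sigma(i,j,k)$ any block transposition on $[n]$. Then $f(\sigma(i,j,k))=\sigma(i-1,j-1,k-1)$ if $i>0$, and $f(\sigma(0,j,k))=\sigma(k-j-1,n-j,n)$. Moreover $g(\sigma(i,j,k))=\sigma(n-k,n-j,n-i)$.
   Context: $\mathrm{Sym}_n$ is the symmetric group on $[n]$, permutations in one-line notation $\pi=[\pi_1\cdots\pi_n]$, $\pi_t=\pi(t)$, $(\pi\circ\rho)(t)=\pi(\rho(t))$. For integers $0\le i<j<k\le n$, the block transposition $\sigma(i,j,k)$ is $[1\cdots i\ \ j+1\cdots k\ \ i+1\cdots j\ \ k+1\cdots n]$. For $\pi\in\mathrm{Sym}_n$ let $[0\,\pi]$ be the permutation of $\{0,\dots,n\}$ fixing $0$ and agreeing with $\pi$ on $[n]$, and $\alpha:x\mapsto x+1\pmod{n+1}$. The toric map $f:\mathrm{Sym}_n\to\mathrm{Sym}_n$ is defined by $[0\,f(\pi)]=\alpha^{n+1-\pi_1}\circ[0\,\pi]\circ\alpha$; equivalently $f(\pi)(t)\equiv[0\,\pi](t+1)-\pi_1 \pmod{n+1}$ with $t+1$ taken mod $n+1$. The reverse map is $g(\pi)(t)=n+1-\pi(n+1-t)$. -}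

module Defs where

open import Data.Nat using (ℕ; zero; suc; _+_; _∸_; _≤_; _<_; _≤ᵇ_; _%_)
open import Data.Bool using (if_then_else_)
open import Relation.Binary.PropositionalEquality using (_≡_)

-- A permutation of [n] in one-line notation is represented by the function
-- t ↦ π(t) on ℕ; only its values on positions 1..n matter.
Perm : Set
Perm = ℕ → ℕ

_≈[_]_ : Perm → ℕ → Perm → Set
π ≈[ n ] ρ = (t : ℕ) → 1 ≤ t → t ≤ n → π t ≡ ρ t

-- Block transposition σ(i,j,k) = [1⋯i  j+1⋯k  i+1⋯j  k+1⋯n]
-- (intended for 0 ≤ i < j < k ≤ n).
σ : ℕ → ℕ → ℕ → Perm
σ i j k t =
  if t ≤ᵇ i then t
  else if t ≤ᵇ i + (k ∸ j) then t + (j ∸ i)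
  else if t ≤ᵇ k then t ∸ (k ∸ j)
  else t

zeroExt : Perm → Perm
zeroExt π zero = zero
zeroExt π (suc s) = π (suc s)

-- Toric map: f(π)(t) ≡ [0 π](t+1 mod (n+1)) − π₁  (mod n+1).
toric : ℕ → Perm → Perm
toric n π t = (zeroExt π (suc t % suc n) + (suc n ∸ π 1)) % suc n

rev : ℕ → Perm → Perm
rev n π t = suc n ∸ π (suc n ∸ t)

-- For i > 0 the block transposition fixes 1, so the toric map just subtracts 1 from
-- π(t+1), and σ(i+1,j+1,k+1)(t+1) = σ(i,j,k)(t) + 1 holds in every branch of the
-- definition of σ; at t = n the argument wraps around to [0 π](0) = 0, giving n.
-- For the other two identities σ(i,j,k) is written through its block sizes, as
-- σ a (a + 1+r) (a + 1+r + 1+q), whose values on the four blocks of positions are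
-- explicit. Each block of the right-hand side is carried by t ↦ t+1 (the toric map, which
-- here subtracts j+1 modulo n+1) or by t ↦ n+1−t (the reverse map) into a block of
-- σ(i,j,k), and what remains are semiring identities between block offsets.

module Submission where

open import Data.Empty using (⊥-elim)
open import Data.List using ([]; _∷_)
open import Data.Nat using (ℕ; zero; suc; _+_; _∸_; _≤_; _<_; _≤ᵇ_; _%_; _≤?_; z≤n; s≤s; z<s)
open import Data.Nat.DivMod using (m<n⇒m%n≡m; n%n≡0; [m+n]%n≡m%n)
open import Data.Nat.Properties
open import Data.Nat.Tactic.RingSolver using (solve)
open import Data.Bool using (true; false)
open import Data.Product using (_×_; _,_; ∃)
open import Data.Sum using (inj₁; inj₂)
open import Relation.Binary.PropositionalEquality
open import Relation.Nullary using (yes; no; contradiction)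

open import Defs

m+o≡n⇒m≤n : ∀ {m n} o → m + o ≡ n → m ≤ n
m+o≡n⇒m≤n {m} o refl = m≤m+n m o

m≡n+o⇒m∸n≡o : ∀ m n {o} → m ≡ n + o → m ∸ n ≡ o
m≡n+o⇒m∸n≡o _ n {o} refl = m+n∸m≡n n o

m<n⇒∃[o]m+[1+o]≡n : ∀ {m n} → m < n → ∃ λ o → m + suc o ≡ n
m<n⇒∃[o]m+[1+o]≡n {m} m<n with m≤n⇒∃[o]m+o≡n m<n
... | o , eq = o , trans (+-suc m o) eq

≤⇒≤ᵇ≡true : ∀ {m n} → m ≤ n → (m ≤ᵇ n) ≡ true
≤⇒≤ᵇ≡true {m} {n} m≤n with m ≤ᵇ n | ≤⇒≤ᵇ m≤n
... | true | _ = refl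

>⇒≤ᵇ≡false : ∀ {m n} → n < m → (m ≤ᵇ n) ≡ false
>⇒≤ᵇ≡false {m} {n} n<m with m ≤ᵇ n | ≤ᵇ⇒≤ m n
... | false | _ = refl
... | true | m≤n = contradiction (m≤n _) (<⇒≱ n<m)

module _ (i j k : ℕ) {t : ℕ} where

  σ-≤i : t ≤ i → σ i j k t ≡ t
  σ-≤i t≤i rewrite ≤⇒≤ᵇ≡true t≤i = refl

  σ-up : i < t → t ≤ i + (k ∸ j) → σ i j k t ≡ t + (j ∸ i)
  σ-up i<t t≤i+[k∸j] rewrite >⇒≤ᵇ≡false i<t | ≤⇒≤ᵇ≡true t≤i+[k∸j] = refl

  σ-down : i + (k ∸ j) < t → t ≤ k → σ i j k t ≡ t ∸ (k ∸ j)
  σ-down i+[k∸j]<t t≤k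
    rewrite >⇒≤ᵇ≡false (≤-<-trans (m≤m+n i (k ∸ j)) i+[k∸j]<t)
          | >⇒≤ᵇ≡false i+[k∸j]<t
          | ≤⇒≤ᵇ≡true t≤k
          = refl

  σ->k : i + (k ∸ j) < t → k < t → σ i j k t ≡ t
  σ->k i+[k∸j]<t k<t
    rewrite >⇒≤ᵇ≡false (≤-<-trans (m≤m+n i (k ∸ j)) i+[k∸j]<t)
          | >⇒≤ᵇ≡false i+[k∸j]<t
          | >⇒≤ᵇ≡false k<t
          = refl

data Branch (i j k t : ℕ) : Set where
  fixed-low  : t ≤ i → Branch i j k t
  moved-up   : i < t → t ≤ i + (k ∸ j) → Branch i j k t
  moved-down : i + (k ∸ j) < t → t ≤ k → Branch i j k t
  fixed-high : i + (k ∸ j) < t → k < t → Branch i j k t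

branch : ∀ i j k t → Branch i j k t
branch i j k t with t ≤? i | t ≤? i + (k ∸ j) | t ≤? k
... | yes t≤i | _                 | _       = fixed-low t≤i
... | no t≰i  | yes t≤i+[k∸j]     | _       = moved-up (≰⇒> t≰i) t≤i+[k∸j]
... | no _    | no t≰i+[k∸j]      | yes t≤k = moved-down (≰⇒> t≰i+[k∸j]) t≤k
... | no _    | no t≰i+[k∸j]      | no t≰k  = fixed-high (≰⇒> t≰i+[k∸j]) (≰⇒> t≰k)

σ-suc : ∀ i j k t → σ (suc i) (suc j) (suc k) (suc t) ≡ suc (σ i j k t)
σ-suc i j k t with branch i j k t
... | fixed-low t≤i =
  trans (σ-≤i (suc i) (suc j) (suc k) (s≤s t≤i))
        (cong suc (sym (σ-≤i i j k t≤i)))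
... | moved-up i<t t≤i+[k∸j] =
  trans (σ-up (suc i) (suc j) (suc k) (s≤s i<t) (s≤s t≤i+[k∸j]))
        (cong suc (sym (σ-up i j k i<t t≤i+[k∸j])))
... | moved-down i+[k∸j]<t t≤k = begin
  σ (suc i) (suc j) (suc k) (suc t)
    ≡⟨ σ-down (suc i) (suc j) (suc k) (s≤s i+[k∸j]<t) (s≤s t≤k) ⟩
  suc t ∸ (k ∸ j)
    ≡⟨ +-∸-assoc 1 (≤-trans (m≤n+m (k ∸ j) i) (<⇒≤ i+[k∸j]<t)) ⟩
  suc (t ∸ (k ∸ j))
    ≡⟨ cong suc (sym (σ-down i j k i+[k∸j]<t t≤k)) ⟩
  suc (σ i j k t)
    ∎
  where open ≡-Reasoning
... | fixed-high i+[k∸j]<t k<t =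
  trans (σ->k (suc i) (suc j) (suc k) (s≤s i+[k∸j]<t) (s≤s k<t))
        (cong suc (sym (σ->k i j k i+[k∸j]<t k<t)))

i+[k∸j]+[j∸i]≡k : ∀ {i j k} → i ≤ j → j ≤ k → i + (k ∸ j) + (j ∸ i) ≡ k
i+[k∸j]+[j∸i]≡k {i} {j} {k} i≤j j≤k = begin
  i + (k ∸ j) + (j ∸ i)   ≡⟨ +-assoc i (k ∸ j) (j ∸ i) ⟩
  i + ((k ∸ j) + (j ∸ i)) ≡⟨ cong (i +_) (+-comm (k ∸ j) (j ∸ i)) ⟩
  i + ((j ∸ i) + (k ∸ j)) ≡⟨ +-assoc i (j ∸ i) (k ∸ j) ⟨
  i + (j ∸ i) + (k ∸ j)   ≡⟨ cong (_+ (k ∸ j)) (m+[n∸m]≡n i≤j) ⟩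
  j + (k ∸ j)             ≡⟨ m+[n∸m]≡n j≤k ⟩
  k                       ∎
  where open ≡-Reasoning

σ-≤ : ∀ {i j k n t} → i ≤ j → j ≤ k → k ≤ n → t ≤ n → σ i j k t ≤ n
σ-≤ {i} {j} {k} {n} {t} i≤j j≤k k≤n t≤n with branch i j k t
... | fixed-low t≤i = ≤-trans (≤-reflexive (σ-≤i i j k t≤i)) t≤n
... | moved-up i<t t≤i+[k∸j] = begin
  σ i j k t             ≡⟨ σ-up i j k i<t t≤i+[k∸j] ⟩
  t + (j ∸ i)           ≤⟨ +-monoˡ-≤ (j ∸ i) t≤i+[k∸j] ⟩
  i + (k ∸ j) + (j ∸ i) ≡⟨ i+[k∸j]+[j∸i]≡k i≤j j≤k ⟩
  k                     ≤⟨ k≤n ⟩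
  n                     ∎
  where open ≤-Reasoning
... | moved-down i+[k∸j]<t t≤k =
  ≤-trans (≤-reflexive (σ-down i j k i+[k∸j]<t t≤k)) (≤-trans (m∸n≤m t (k ∸ j)) t≤n)
... | fixed-high i+[k∸j]<t k<t = ≤-trans (≤-reflexive (σ->k i j k i+[k∸j]<t k<t)) t≤n

σ-beyond : ∀ {i j k t} → i ≤ j → j ≤ k → k < t → σ i j k t ≡ t
σ-beyond {i} {j} {k} i≤j j≤k k<t = σ->k i j k (≤-<-trans i+[k∸j]≤k k<t) k<t
  where
  i+[k∸j]≤k : i + (k ∸ j) ≤ k
  i+[k∸j]≤k = ≤-trans (m≤m+n (i + (k ∸ j)) (j ∸ i)) (≤-reflexive (i+[k∸j]+[j∸i]≡k i≤j j≤k))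

toric-<n : ∀ {n t} (π : Perm) → t < n → toric n π t ≡ (π (suc t) + (suc n ∸ π 1)) % suc n
toric-<n {n} π t<n = cong (λ s → (zeroExt π s + (suc n ∸ π 1)) % suc n) (m<n⇒m%n≡m (s≤s t<n))

toric-no-wrap : ∀ n t {u s} (π : Perm) v → t < n → π (suc t) ≡ u → suc n ∸ π 1 ≡ s →
  u + s ≡ v → v < suc n → toric n π t ≡ v
toric-no-wrap n t π v t<n πt≡u offset u+s≡v v<1+n = begin
  toric n π t                         ≡⟨ toric-<n π t<n ⟩
  (π (suc t) + (suc n ∸ π 1)) % suc n ≡⟨ cong (_% suc n) (trans (cong₂ _+_ πt≡u offset) u+s≡v) ⟩
  v % suc n                           ≡⟨ m<n⇒m%n≡m v<1+n ⟩
  v                                   ∎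
  where open ≡-Reasoning

toric-wrap : ∀ n t {u s} (π : Perm) v → t < n → π (suc t) ≡ u → suc n ∸ π 1 ≡ s →
  u + s ≡ v + suc n → v < suc n → toric n π t ≡ v
toric-wrap n t π v t<n πt≡u offset u+s≡v+1+n v<1+n = begin
  toric n π t                         ≡⟨ toric-<n π t<n ⟩
  (π (suc t) + (suc n ∸ π 1)) % suc n ≡⟨ cong (_% suc n) (trans (cong₂ _+_ πt≡u offset) u+s≡v+1+n) ⟩
  (v + suc n) % suc n                 ≡⟨ [m+n]%n≡m%n v (suc n) ⟩
  v % suc n                           ≡⟨ m<n⇒m%n≡m v<1+n ⟩
  v                                   ∎
  where open ≡-Reasoning

toric-last : ∀ n t (π : Perm) v → t ≡ n → suc n ∸ π 1 ≡ v → v < suc n → toric n π t ≡ v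
toric-last n _ π v refl offset v<1+n = begin
  toric n π n                 ≡⟨ cong (λ s → (zeroExt π s + (suc n ∸ π 1)) % suc n) (n%n≡0 (suc n)) ⟩
  (suc n ∸ π 1) % suc n       ≡⟨ cong (_% suc n) offset ⟩
  v % suc n                   ≡⟨ m<n⇒m%n≡m v<1+n ⟩
  v                           ∎
  where open ≡-Reasoning

offset-σ-suc : ∀ n a b c → suc n ∸ σ (suc a) (suc b) (suc c) 1 ≡ n
offset-σ-suc n a b c = cong (suc n ∸_) (σ-≤i (suc a) (suc b) (suc c) (s≤s z≤n))

toric-σ-suc : ∀ {n a b c} → a ≤ b → b ≤ c → c < n →
  toric n (σ (suc a) (suc b) (suc c)) ≈[ n ] σ a b c
toric-σ-suc {n} {a} {b} {c} a≤b b≤c c<n t _ t≤n with m≤n⇒m<n∨m≡n t≤n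
... | inj₁ t<n = toric-wrap n t (σ (suc a) (suc b) (suc c)) (σ a b c t) t<n
  (σ-suc a b c t)
  (offset-σ-suc n a b c)
  (sym (+-suc (σ a b c t) n))
  (s≤s (σ-≤ a≤b b≤c (<⇒≤ c<n) (<⇒≤ t<n)))
... | inj₂ refl = trans
  (toric-last n n (σ (suc a) (suc b) (suc c)) n refl (offset-σ-suc n a b c) (n<1+n n))
  (sym (σ-beyond a≤b b≤c c<n))

module BlockForm (a r q : ℕ) where

  private
    j k : ℕ
    j = a + suc r
    k = j + suc q

    k∸j≡1+q : k ∸ j ≡ suc q
    k∸j≡1+q = m+n∸m≡n j (suc q)

  σ-prefix : ∀ {t} → t ≤ a → σ a (a + suc r) (a + suc r + suc q) t ≡ t
  σ-prefix = σ-≤i a j k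

  σ-block₁ : ∀ {x} → x ≤ q → σ a (a + suc r) (a + suc r + suc q) (a + suc x) ≡ a + suc x + suc r
  σ-block₁ {x} x≤q = begin
    σ a j k (a + suc x) ≡⟨ σ-up a j k (m<m+n a z<s) t≤a+[k∸j] ⟩
    a + suc x + (j ∸ a) ≡⟨ cong (a + suc x +_) (m+n∸m≡n a (suc r)) ⟩
    a + suc x + suc r   ∎
    where
    open ≡-Reasoning
    t≤a+[k∸j] : a + suc x ≤ a + (k ∸ j)
    t≤a+[k∸j] = subst (λ b → a + suc x ≤ a + b) (sym k∸j≡1+q) (+-monoʳ-≤ a (s≤s x≤q))

  σ-block₂ : ∀ {x} → x ≤ r → σ a (a + suc r) (a + suc r + suc q) (a + suc q + suc x) ≡ a + suc x
  σ-block₂ {x} x≤r = begin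
    σ a j k (a + suc q + suc x)
      ≡⟨ σ-down a j k a+[k∸j]<t t≤k ⟩
    a + suc q + suc x ∸ (k ∸ j)
      ≡⟨ cong (a + suc q + suc x ∸_) k∸j≡1+q ⟩
    a + suc q + suc x ∸ suc q
      ≡⟨ m≡n+o⇒m∸n≡o (a + suc q + suc x) (suc q) (solve (a ∷ q ∷ x ∷ [])) ⟩
    a + suc x
      ∎
    where
    open ≡-Reasoning
    a+[k∸j]<t : a + (k ∸ j) < a + suc q + suc x
    a+[k∸j]<t = subst (λ b → a + b < a + suc q + suc x) (sym k∸j≡1+q) (m<m+n (a + suc q) z<s)
    t≤k : a + suc q + suc x ≤ a + suc r + suc q
    t≤k = subst (a + suc q + suc x ≤_) {a + suc q + suc r} (solve (a ∷ q ∷ r ∷ []))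
            (+-monoʳ-≤ (a + suc q) (s≤s x≤r))

  σ-suffix : ∀ x →
    σ a (a + suc r) (a + suc r + suc q) (a + suc r + suc q + suc x) ≡ a + suc r + suc q + suc x
  σ-suffix x = σ-beyond (m≤m+n a (suc r)) (m≤m+n j (suc q)) (m<m+n k z<s)

  data Region : ℕ → Set where
    prefix : ∀ {t} → t ≤ a → Region t
    block₁ : ∀ x → x ≤ q → Region (a + suc x)
    block₂ : ∀ x → x ≤ r → Region (a + suc q + suc x)
    suffix : ∀ x → Region (a + suc r + suc q + suc x)

  region : ∀ t → Region t
  region t with t ≤? a
  ... | yes t≤a = prefix t≤a
  ... | no t≰a with m<n⇒∃[o]m+[1+o]≡n (≰⇒> t≰a)
  ...   | x , refl with x ≤? q
  ...     | yes x≤q = block₁ x x≤q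
  ...     | no x≰q with m<n⇒∃[o]m+[1+o]≡n (≰⇒> x≰q)
  ...       | y , refl with y ≤? r
  ...         | yes y≤r =
    subst Region {a + suc q + suc y} (solve (a ∷ q ∷ y ∷ [])) (block₂ y y≤r)
  ...         | no y≰r with m<n⇒∃[o]m+[1+o]≡n (≰⇒> y≰r)
  ...           | z , refl =
    subst Region {a + suc r + suc q + suc z} (solve (a ∷ q ∷ r ∷ z ∷ [])) (suffix z)

open BlockForm

rev-complement : ∀ n t {v} (π : Perm) u w →
  t + u ≡ suc n → π u ≡ v → v + w ≡ suc n → rev n π t ≡ w
rev-complement n t {v} π u w t+u≡1+n πu≡v v+w≡1+n = begin
  suc n ∸ π (suc n ∸ t) ≡⟨ cong (λ s → suc n ∸ π s) (m≡n+o⇒m∸n≡o (suc n) t (sym t+u≡1+n)) ⟩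
  suc n ∸ π u           ≡⟨ cong (suc n ∸_) πu≡v ⟩
  suc n ∸ v             ≡⟨ m≡n+o⇒m∸n≡o (suc n) v (sym v+w≡1+n) ⟩
  w                     ∎
  where open ≡-Reasoning

rev-σ-blocks : ∀ i r q p →
  rev (i + suc r + suc q + p) (σ i (i + suc r) (i + suc r + suc q))
    ≈[ i + suc r + suc q + p ] σ p (p + suc q) (p + suc q + suc r)
rev-σ-blocks i r q p t _ t≤n with region p q r t
... | prefix t≤p with m≤n⇒∃[o]m+o≡n t≤p
...   | y , refl = trans
  (rev-complement (i + suc r + suc q + (t + y)) t
    (σ i (i + suc r) (i + suc r + suc q))
    (i + suc r + suc q + suc y) t
    (solve (t ∷ i ∷ r ∷ q ∷ y ∷ []))
    (σ-suffix i r q y)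
    (solve (t ∷ i ∷ r ∷ q ∷ y ∷ [])))
  (sym (σ-prefix p q r t≤p))
rev-σ-blocks i r q p t _ t≤n | block₁ x x≤r with m≤n⇒∃[o]m+o≡n x≤r
...   | y , refl = trans
  (rev-complement (i + suc (x + y) + suc q + p) (p + suc x)
    (σ i (i + suc (x + y)) (i + suc (x + y) + suc q))
    (i + suc q + suc y) (p + suc x + suc q)
    (solve (p ∷ x ∷ i ∷ q ∷ y ∷ []))
    (σ-block₂ i (x + y) q (m≤n+m y x))
    (solve (p ∷ x ∷ i ∷ q ∷ y ∷ [])))
  (sym (σ-block₁ p q (x + y) x≤r))
rev-σ-blocks i r q p t _ t≤n | block₂ x x≤q with m≤n⇒∃[o]m+o≡n x≤q
...   | y , refl = trans
  (rev-complement (i + suc r + suc (x + y) + p) (p + suc r + suc x)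
    (σ i (i + suc r) (i + suc r + suc (x + y)))
    (i + suc y) (p + suc x)
    (solve (p ∷ x ∷ i ∷ r ∷ y ∷ []))
    (σ-block₁ i r (x + y) (m≤n+m y x))
    (solve (p ∷ x ∷ i ∷ r ∷ y ∷ [])))
  (sym (σ-block₂ p (x + y) r x≤q))
rev-σ-blocks i r q p t _ t≤n | suffix x
  with m≤n⇒∃[o]m+o≡n (+-cancelˡ-≤ (p + suc q + suc r) (suc x) i
         (≤-trans t≤n (≤-reflexive (solve (i ∷ r ∷ q ∷ p ∷ [])))))
...   | y , refl = trans
  (rev-complement (suc x + y + suc r + suc q + p) (p + suc q + suc r + suc x)
    (σ (suc x + y) (suc x + y + suc r) (suc x + y + suc r + suc q))
    (suc y) (p + suc q + suc r + suc x)
    (solve (p ∷ q ∷ r ∷ x ∷ y ∷ []))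
    (σ-prefix (suc x + y) r q (s≤s (m≤n+m y x)))
    (solve (p ∷ q ∷ r ∷ x ∷ y ∷ [])))
  (sym (σ-suffix p q r x))

offset-σ-0 : ∀ r q p → suc (suc r + suc q + p) ∸ σ 0 (suc r) (suc r + suc q) 1 ≡ suc q + p
offset-σ-0 r q p = begin
  suc (suc r + suc q + p) ∸ σ 0 (suc r) (suc r + suc q) 1
    ≡⟨ cong (suc (suc r + suc q + p) ∸_) (σ-block₁ 0 r q z≤n) ⟩
  suc r + suc q + p ∸ suc r
    ≡⟨ m≡n+o⇒m∸n≡o (suc r + suc q + p) (suc r) (+-assoc (suc r) (suc q) p) ⟩
  suc q + p
    ∎
  where open ≡-Reasoning

toric-σ-0-blocks : ∀ r q p →
  toric (suc r + suc q + p) (σ 0 (suc r) (suc r + suc q))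
    ≈[ suc r + suc q + p ] σ q (q + suc p) (q + suc p + suc r)
toric-σ-0-blocks r q p t _ t≤n with region q p r t
... | prefix t≤q with m≤n⇒∃[o]m+o≡n t≤q
...   | y , refl = trans
  (toric-wrap (suc r + suc (t + y) + p) t (σ 0 (suc r) (suc r + suc (t + y))) t
    (m+o≡n⇒m≤n (y + suc r + p) (solve (t ∷ y ∷ r ∷ p ∷ [])))
    (σ-block₁ 0 r (t + y) t≤q)
    (offset-σ-0 r (t + y) p)
    (solve (t ∷ y ∷ r ∷ p ∷ []))
    (s≤s t≤n))
  (sym (σ-prefix (t + y) p r t≤q))
toric-σ-0-blocks r q p t _ t≤n | block₁ x x≤r with m≤n⇒∃[o]m+o≡n x≤r
...   | y , refl = trans
  (toric-no-wrap (suc (x + y) + suc q + p) (q + suc x) (σ 0 (suc (x + y)) (suc (x + y) + suc q))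
    (q + suc x + suc p)
    (m+o≡n⇒m≤n (y + p) (solve (q ∷ x ∷ y ∷ p ∷ [])))
    (σ-block₂ 0 (x + y) q (m≤m+n x y))
    (offset-σ-0 (x + y) q p)
    (solve (q ∷ x ∷ p ∷ []))
    (m+o≡n⇒m≤n y (solve (q ∷ x ∷ y ∷ p ∷ []))))
  (sym (σ-block₁ q p (x + y) x≤r))
toric-σ-0-blocks r q p t _ t≤n | block₂ x x≤p with m≤n⇒∃[o]m+o≡n x≤p
...   | zero , refl = trans
  (toric-last (suc r + suc q + (x + 0)) (q + suc r + suc x) (σ 0 (suc r) (suc r + suc q)) (q + suc x)
    (solve (q ∷ r ∷ x ∷ []))
    (trans (offset-σ-0 r q (x + 0)) (solve (q ∷ x ∷ [])))
    (m+o≡n⇒m≤n (suc r) (solve (q ∷ r ∷ x ∷ []))))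
  (sym (σ-block₂ q (x + 0) r x≤p))
...   | suc z , refl = trans
  (toric-wrap (suc r + suc q + (x + suc z)) (q + suc r + suc x) σ₀ (q + suc x)
    (m+o≡n⇒m≤n z (solve (q ∷ r ∷ x ∷ z ∷ [])))
    (trans (cong σ₀ {suc (q + suc r + suc x)} {suc r + suc q + suc x} (solve (q ∷ r ∷ x ∷ [])))
           (σ-suffix 0 r q x))
    (offset-σ-0 r q (x + suc z))
    (solve (q ∷ r ∷ x ∷ z ∷ []))
    (m+o≡n⇒m≤n (r + suc (suc z)) (solve (q ∷ r ∷ x ∷ z ∷ []))))
  (sym (σ-block₂ q (x + suc z) r x≤p))
  where σ₀ = σ 0 (suc r) (suc r + suc q)
toric-σ-0-blocks r q p t _ t≤n | suffix x =
  ⊥-elim (≤⇒≯ t≤n (m+o≡n⇒m≤n x (solve (q ∷ p ∷ r ∷ x ∷ []))))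

σ-cong : ∀ {i i′ j j′ k k′} t → i ≡ i′ → j ≡ j′ → k ≡ k′ → σ i j k t ≡ σ i′ j′ k′ t
σ-cong t refl refl refl = refl

toric-σ : ∀ {n i j k} → i < j → j < k → k ≤ n → 0 < i →
  toric n (σ i j k) ≈[ n ] σ (i ∸ 1) (j ∸ 1) (k ∸ 1)
toric-σ {i = suc a} {suc b} {suc c} (s≤s a<b) (s≤s b<c) c<n _ = toric-σ-suc (<⇒≤ a<b) (<⇒≤ b<c) c<n

toric-σ-0 : ∀ {n j k} → 0 < j → j < k → k ≤ n → toric n (σ 0 j k) ≈[ n ] σ (k ∸ j ∸ 1) (n ∸ j) n
toric-σ-0 {j = suc r} _ j<k k≤n with m<n⇒∃[o]m+[1+o]≡n j<k
... | q , refl with m≤n⇒∃[o]m+o≡n k≤n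
...   | p , refl = λ t 1≤t t≤n → trans (toric-σ-0-blocks r q p t 1≤t t≤n) (σ-cong t
  (sym (cong (_∸ 1) (m+n∸m≡n (suc r) (suc q))))
  (sym (m≡n+o⇒m∸n≡o (suc r + suc q + p) (suc r) (solve (r ∷ q ∷ p ∷ []))))
  (solve (q ∷ p ∷ r ∷ [])))

rev-σ : ∀ {n i j k} → i < j → j < k → k ≤ n → rev n (σ i j k) ≈[ n ] σ (n ∸ k) (n ∸ j) (n ∸ i)
rev-σ {i = i} i<j j<k k≤n with m<n⇒∃[o]m+[1+o]≡n i<j
... | r , refl with m<n⇒∃[o]m+[1+o]≡n j<k
...   | q , refl with m≤n⇒∃[o]m+o≡n k≤n
...     | p , refl = λ t 1≤t t≤n → trans (rev-σ-blocks i r q p t 1≤t t≤n) (σ-cong t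
  (sym (m+n∸m≡n (i + suc r + suc q) p))
  (sym (m≡n+o⇒m∸n≡o (i + suc r + suc q + p) (i + suc r) (solve (i ∷ r ∷ q ∷ p ∷ []))))
  (sym (m≡n+o⇒m∸n≡o (i + suc r + suc q + p) i (solve (i ∷ r ∷ q ∷ p ∷ [])))))

lemma2 : (n : ℕ) → 1 ≤ n →
    ((i j k : ℕ) → i < j → j < k → k ≤ n → 0 < i →
      toric n (σ i j k) ≈[ n ] σ (i ∸ 1) (j ∸ 1) (k ∸ 1))
    × ((j k : ℕ) → 0 < j → j < k → k ≤ n →
      toric n (σ 0 j k) ≈[ n ] σ (k ∸ j ∸ 1) (n ∸ j) n)
    × ((i j k : ℕ) → i < j → j < k → k ≤ n →
      rev n (σ i j k) ≈[ n ] σ (n ∸ k) (n ∸ j) (n ∸ i))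
-- 1 ≤ n is implied by the hypotheses of each part.
lemma2 n _ = (λ _ _ _ → toric-σ) , (λ _ _ → toric-σ-0) , (λ _ _ _ → rev-σ)
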